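{- Let $q$ be a prime power, $n=tt'$ with integers $t,t'\ge2$ and $\gcd(t,t')=1$. Then every L-$q^t$-partially scattered $q$-polynomial $f(x)=\sum_{i=0}^{n-1}a_ix^{q^i}\in\mathbb{F}_{q^n}[x]$ is also R-$q^{t'}$-partially scattered.
   Context: For a divisor $d$ of $n$ with $1<d<n$, a $q$-polynomial $f$ over $\mathbb{F}_{q^n}$ is L-$q^d$-partially scattered if for all $y,z\in\mathbb{F}_{q^n}^*$, $f(y)/y=f(z)/z$ implies $y/z\in\mathbb{F}_{q^d}$; it is R-$q^d$-partially scattered if for all $y,z\in\mathbb{F}_{q^n}^*$, $f(y)/y=f(z)/z$ and $y/z\in\mathbb{F}_{q^d}$ imply $y/z\in\mathbb{F}_q$. -}

module Defs where

open import Level using (Level; _⊔_) renaming (suc to lsuc)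
open import Data.Nat using (ℕ; _^_; _≤_)
open import Data.Nat.Primality using (Prime)
open import Data.Fin using (Fin; toℕ)
open import Data.Product using (Σ; ∃; _×_)
open import Relation.Nullary using (¬_)
open import Relation.Binary.PropositionalEquality using (_≡_)
open import Algebra.Bundles using (CommutativeRing; Semiring)
import Algebra.Definitions.RawSemiring as RS

IsPrimePower : ℕ → Set
IsPrimePower q = Σ ℕ λ p → Σ ℕ λ k → Prime p × (1 ≤ k) × (q ≡ p ^ k)

record FiniteField (c ℓ : Level) : Set (lsuc (c ⊔ ℓ)) where
  field
    commRing : CommutativeRing c ℓ
  open CommutativeRing commRing public
  field
    0≉1       : ¬ (0# ≈ 1#)
    _⁻¹       : Carrier → Carrier
    ⁻¹-inverse : ∀ x → ¬ (x ≈ 0#) → (x * (x ⁻¹)) ≈ 1#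
    size      : ℕ
    enum      : Fin size → Carrier
    enum-injective  : ∀ i j → enum i ≈ enum j → i ≡ j
    enum-surjective : ∀ x → ∃ λ i → enum i ≈ x

module _ {c ℓ : Level} (F : FiniteField c ℓ) where
  open FiniteField F
  open RS (Semiring.rawSemiring semiring) using (sum) renaming (_^_ to _^F_)

  _÷_ : Carrier → Carrier → Carrier
  y ÷ z = y * (z ⁻¹)

  InSubfield : (q d : ℕ) → Carrier → Set ℓ
  InSubfield q d x = (x ^F (q ^ d)) ≈ x

  qpolyEval : (q n : ℕ) → (Fin n → Carrier) → Carrier → Carrier
  qpolyEval q n a y = sum (λ i → a i * (y ^F (q ^ toℕ i)))

  LPartiallyScattered : (q n : ℕ) → (Fin n → Carrier) → (d : ℕ) → Set (c ⊔ ℓ)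
  LPartiallyScattered q n a d =
    ∀ y z → ¬ (y ≈ 0#) → ¬ (z ≈ 0#) →
      (qpolyEval q n a y ÷ y) ≈ (qpolyEval q n a z ÷ z) →
      InSubfield q d (y ÷ z)

  RPartiallyScattered : (q n : ℕ) → (Fin n → Carrier) → (d : ℕ) → Set (c ⊔ ℓ)
  RPartiallyScattered q n a d =
    ∀ y z → ¬ (y ≈ 0#) → ¬ (z ≈ 0#) →
      (qpolyEval q n a y ÷ y) ≈ (qpolyEval q n a z ÷ z) →
      InSubfield q d (y ÷ z) →
      InSubfield q 1 (y ÷ z)

-- If y/z lies in both F_{q^t} and F_{q^t′}, then it is fixed by the Frobenius powers
-- x ↦ x^{q^t} and x ↦ x^{q^t′}, hence by x ↦ x^{q^(a t)} for every multiple a t of t and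
-- likewise for t′.  Bézout for coprime t, t′ gives 1 + b t′ = a t (up to swapping the
-- roles), so x^q = (x^{q^(b t′)})^q = x^{q^(a t)} = x: the intersection is F_q.
module Submission where

open import Defs
open import Level using (Level)
open import Data.Nat using (ℕ; _*_; _^_; _≤_; _+_; zero; suc)
open import Data.Nat.Coprimality using (Coprime; coprime-Bézout)
open import Data.Nat.GCD using (module Bézout)
import Data.Nat.Properties as ℕ
open import Data.Fin using (Fin)
open import Relation.Binary.PropositionalEquality using (_≡_; cong)
open import Algebra.Bundles using (Semiring)
import Algebra.Properties.Semiring.Exp as Exp
import Relation.Binary.Reasoning.Setoid as SetoidReasoning

module FrobeniusFixed {c ℓ : Level} (R : Semiring c ℓ) (q : ℕ) where
  open Semiring R using (Carrier; _≈_; setoid; *-identityʳ; sym)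
  open Exp R using (^-congʳ; ^-congˡ; ^-assocʳ) renaming (_^_ to _^R_)
  open SetoidReasoning setoid

  FixedBy : ℕ → Carrier → Set ℓ
  FixedBy k x = x ^R (q ^ k) ≈ x

  fixedBy-multiple : ∀ k m {x} → FixedBy k x → FixedBy (m * k) x
  fixedBy-multiple k zero {x} _ = *-identityʳ x
  fixedBy-multiple k (suc m) {x} fixed = begin
    x ^R (q ^ (k + m * k))            ≈⟨ ^-congʳ x (ℕ.^-distribˡ-+-* q k (m * k)) ⟩
    x ^R (q ^ k * q ^ (m * k))        ≈⟨ sym (^-assocʳ x (q ^ k) (q ^ (m * k))) ⟩
    (x ^R (q ^ k)) ^R (q ^ (m * k))   ≈⟨ ^-congˡ (q ^ (m * k)) fixed ⟩
    x ^R (q ^ (m * k))                ≈⟨ fixedBy-multiple k m fixed ⟩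
    x                                 ∎

  fixedBy-1-of-Bézout : ∀ u v a b {x} → 1 + b * v ≡ a * u →
                        FixedBy u x → FixedBy v x → FixedBy 1 x
  fixedBy-1-of-Bézout u v a b {x} bézout fixedᵤ fixedᵥ = begin
    x ^R (q ^ 1)                  ≈⟨ ^-congʳ x (ℕ.*-identityʳ q) ⟩
    x ^R q                        ≈⟨ sym (^-congˡ q (fixedBy-multiple v b fixedᵥ)) ⟩
    (x ^R (q ^ (b * v))) ^R q     ≈⟨ ^-assocʳ x (q ^ (b * v)) q ⟩
    x ^R (q ^ (b * v) * q)        ≈⟨ ^-congʳ x (ℕ.*-comm (q ^ (b * v)) q) ⟩
    x ^R (q ^ (1 + b * v))        ≈⟨ ^-congʳ x (cong (q ^_) bézout) ⟩
    x ^R (q ^ (a * u))            ≈⟨ fixedBy-multiple u a fixedᵤ ⟩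
    x                             ∎

  fixedBy-coprime : ∀ {t t′ x} → Coprime t t′ →
                    FixedBy t x → FixedBy t′ x → FixedBy 1 x
  fixedBy-coprime {t} {t′} coprime fixed fixed′ with coprime-Bézout coprime
  ... | Bézout.+- a b eq = fixedBy-1-of-Bézout t t′ a b eq fixed fixed′
  ... | Bézout.-+ a b eq = fixedBy-1-of-Bézout t′ t b a eq fixed′ fixed

proposition2p7 : {c ℓ : Level} (q : ℕ) → IsPrimePower q →
    (t t′ : ℕ) → 2 ≤ t → 2 ≤ t′ → Coprime t t′ →
    (F : FiniteField c ℓ) → FiniteField.size F ≡ q ^ (t * t′) →
    (a : Fin (t * t′) → FiniteField.Carrier F) →
    LPartiallyScattered F q (t * t′) a t →
    RPartiallyScattered F q (t * t′) a t′
proposition2p7 q _ t t′ _ _ coprime F _ a scatteredL y z y≉0 z≉0 sameRatio inSubfield′ =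
  fixedBy-coprime coprime (scatteredL y z y≉0 z≉0 sameRatio) inSubfield′
  where open FrobeniusFixed (FiniteField.semiring F) q
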